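{- For any signature $S$ and any word $w$ on $S$, the map $t\mapsto\mathrm{cnc}(t)$, restricted to the set of $S$-terms $t$ with $\mathrm{dc}(t)=w$, is injective.
   Context: A signature is a set $S$ with an arity map $|\cdot|:S\to\mathbb N$. An $S$-term is either the leaf $\ell$ or $s\,t_1\cdots t_{|s|}$ with $s\in S$ and $S$-terms $t_i$. Internal nodes of $t$ are numbered $1,\dots,\deg t$ in preorder (root, then subterms from left to right recursively); $\mathrm{dc}(t)$ is the word of decorations of the internal nodes in this order. Children (leaves included) are numbered from $1$ left to right; the parent edge of internal node $i$ is $(\mathrm{pa}(i),\mathrm{lp}(i),i)$ with $i$ the $\mathrm{lp}(i)$-th child of $\mathrm{pa}(i)$, with the convention $\mathrm{pa}(1)=1,\mathrm{lp}(1)=0$. The connection word $\mathrm{cnc}(t)$ is the word over $\mathbb Q$ of length $\deg t$ with $\mathrm{cnc}(t)(i)=\mathrm{pa}(i)+1-2^{\mathrm{lp}(i)-a}$, where $a$ is the arity of the decoration of $\mathrm{pa}(i)$. -}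

module Defs where

open import Data.Nat as ℕ using (ℕ; zero; suc)
open import Data.Nat.Properties using (m^n≢0)
open import Data.Integer as ℤ using (ℤ; +_; -[1+_])
open import Data.Rational as ℚ using (ℚ)
open import Data.List using (List; []; _∷_; _++_)
open import Data.Vec using (Vec; []; _∷_)

data Term {S : Set} (arity : S → ℕ) : Set where
  leaf : Term arity
  node : (s : S) → Vec (Term arity) (arity s) → Term arity

pow2 : ℤ → ℚ
pow2 (+ n) = (+ (2 ℕ.^ n)) ℚ./ 1
pow2 -[1+ n ] = (+ 1) ℚ./ (2 ℕ.^ suc n)
  where instance _ = m^n≢0 2 (suc n)

module _ {S : Set} {arity : S → ℕ} where

  mutual
    deg : Term arity → ℕ
    deg leaf = 0
    deg (node s ts) = suc (degs ts)

    degs : ∀ {n} → Vec (Term arity) n → ℕ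
    degs [] = 0
    degs (t ∷ ts) = deg t ℕ.+ degs ts

  mutual
    dc : Term arity → List S
    dc leaf = []
    dc (node s ts) = s ∷ dcs ts

    dcs : ∀ {n} → Vec (Term arity) n → List S
    dcs [] = []
    dcs (t ∷ ts) = dc t ++ dcs ts

  letter : (pa a lp : ℕ) → ℚ
  letter pa a lp = ((+ pa) ℚ./ 1) ℚ.+ ((+ 1) ℚ./ 1) ℚ.- pow2 ((+ lp) ℤ.- (+ a))

  mutual
    -- cncT pa a lp i t : connection letters of the internal nodes of a subterm t
    -- whose root (if internal) gets preorder number i, is the lp-th child of the
    -- internal node number pa, and a is the arity of the decoration of pa.
    cncT : (pa a lp i : ℕ) → Term arity → List ℚ
    cncT pa a lp i leaf = []
    cncT pa a lp i (node s ts) = letter pa a lp ∷ cncV i (arity s) 1 (suc i) ts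

    -- children processed left to right, k = position of the first one,
    -- i = preorder number the first internal node among them would get
    cncV : ∀ {n} (pa a k i : ℕ) → Vec (Term arity) n → List ℚ
    cncV pa a k i [] = []
    cncV pa a k i (t ∷ ts) = cncT pa a k i t ++ cncV pa a (suc k) (i ℕ.+ deg t) ts

  -- connection word; root convention pa(1) = 1, lp(1) = 0
  cnc : Term arity → List ℚ
  cnc leaf = []
  cnc (node s ts) = cncT 1 (arity s) 0 1 (node s ts)

-- Since lp ≤ a, every letter  pa + 1 − 2^(lp − a)  lies in [pa, pa + 1) and strictly
-- decreases with lp. Reading cnc(t) from left to right with dc(t) known, the next
-- letter therefore tells whether the next child of the current node is internal
-- (the letter of node pa at exactly the expected position lp) or a leaf (a letter of
-- pa at a larger position, or a letter below pa once its children are exhausted).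
-- So t can be parsed back from dc(t) and cnc(t).
module Submission where

open import Data.Empty using (⊥-elim)
open import Data.Integer as ℤ using (+_)
import Data.Integer.Properties as ℤ
open import Data.List using (List; []; _∷_; _++_)
open import Data.List.Properties using (++-assoc; ∷-injective)
open import Data.Nat as ℕ using (ℕ; zero; suc; NonZero; _≤_; _<_; _+_; _∸_; _^_; s≤s; z≤n)
import Data.Nat.Properties as ℕ
import Data.Nat.Coprimality as Coprime
open import Data.Product using (_×_; _,_; proj₁; proj₂)
open import Data.Rational as ℚ using (ℚ; mkℚ; 0ℚ; 1ℚ)
open import Data.Rational.Properties
open import Algebra.Properties.Group +-0-group using (//-rightDividesʳ)
open import Data.Unit using (⊤; tt)
open import Data.Vec using (Vec; []; _∷_)
open import Relation.Binary.PropositionalEquality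

open import Defs

n/1≡mkℚ : ∀ n → + n ℚ./ 1 ≡ mkℚ (+ n) 0 (Coprime.sym (Coprime.1-coprimeTo n))
n/1≡mkℚ n = normalize-coprime _

1/n≡mkℚ : ∀ n .{{_ : NonZero n}} →
          + 1 ℚ./ n ≡ mkℚ (+ 1) (ℕ.pred n) (Coprime.1-coprimeTo (suc (ℕ.pred n)))
1/n≡mkℚ n = trans (/-cong {+ 1} {n} refl (sym (ℕ.suc-pred n))) (normalize-coprime _)

n/1-mono-≤ : ∀ {m n} → m ≤ n → + m ℚ./ 1 ℚ.≤ + n ℚ./ 1
n/1-mono-≤ {m} {n} m≤n rewrite n/1≡mkℚ m | n/1≡mkℚ n =
  ℚ.*≤* (subst₂ ℤ._≤_ (sym (ℤ.*-identityʳ _)) (sym (ℤ.*-identityʳ _)) (ℤ.+≤+ m≤n))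

n/1+1≡suc-n/1 : ∀ n → + n ℚ./ 1 ℚ.+ 1ℚ ≡ + suc n ℚ./ 1
n/1+1≡suc-n/1 n rewrite n/1≡mkℚ n =
  /-cong (trans (cong (ℤ._+ + 1) (ℤ.*-identityʳ (+ n))) (cong +_ (ℕ.+-comm n 1))) refl

1/n-pos : ∀ n .{{_ : NonZero n}} → 0ℚ ℚ.< + 1 ℚ./ n
1/n-pos n = subst (0ℚ ℚ.<_) (sym (1/n≡mkℚ n)) (ℚ.*<* (ℤ.+<+ (s≤s z≤n)))

1/n-antimono-< : ∀ m n .{{_ : NonZero m}} .{{_ : NonZero n}} →
                 m < n → + 1 ℚ./ n ℚ.< + 1 ℚ./ m
1/n-antimono-< m n m<n = subst₂ ℚ._<_ (sym (1/n≡mkℚ n)) (sym (1/n≡mkℚ m))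
  (ℚ.*<* (subst₂ ℤ._<_ (sym (ℤ.*-identityˡ _)) (sym (ℤ.*-identityˡ _))
    (ℤ.+<+ (subst₂ _<_ (sym (ℕ.suc-pred m)) (sym (ℕ.suc-pred n)) m<n))))

half^ : ℕ → ℚ
half^ d = (+ 1 ℚ./ 2 ^ d) {{ℕ.m^n≢0 2 d}}

half^-pos : ∀ d → 0ℚ ℚ.< half^ d
half^-pos d = 1/n-pos (2 ^ d) {{ℕ.m^n≢0 2 d}}

half^-strictlyDecreasing : ∀ {d d′} → d < d′ → half^ d′ ℚ.< half^ d
half^-strictlyDecreasing {d} {d′} d<d′ =
  1/n-antimono-< (2 ^ d) (2 ^ d′) {{ℕ.m^n≢0 2 d}} {{ℕ.m^n≢0 2 d′}}
    (ℕ.^-monoʳ-< 2 (s≤s (s≤s z≤n)) d<d′)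

half^-≤-1 : ∀ d → half^ d ℚ.≤ 1ℚ
half^-≤-1 zero    = ≤-refl
half^-≤-1 (suc d) = <⇒≤ (half^-strictlyDecreasing (s≤s (z≤n {d})))

pow2-neg : ∀ d → pow2 (ℤ.- + d) ≡ half^ d
pow2-neg zero    = refl
pow2-neg (suc d) = refl

module _ {S : Set} {arity : S → ℕ} where

  private
    letter′ : ℕ → ℕ → ℕ → ℚ
    letter′ = letter {S} {arity}

  letter-≡ : ∀ p {a l} → l ≤ a → letter′ p a l ≡ + p ℚ./ 1 ℚ.+ 1ℚ ℚ.- half^ (a ∸ l)
  letter-≡ p {a} {l} l≤a = cong (λ x → + p ℚ./ 1 ℚ.+ 1ℚ ℚ.- x) (begin
    pow2 (+ l ℤ.- + a)    ≡⟨ cong pow2 (ℤ.m-n≡m⊖n l a) ⟩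
    pow2 (l ℤ.⊖ a)        ≡⟨ cong pow2 (ℤ.⊖-≤ l≤a) ⟩
    pow2 (ℤ.- + (a ∸ l))  ≡⟨ pow2-neg (a ∸ l) ⟩
    half^ (a ∸ l)         ∎)
    where open ≡-Reasoning

  letter-≥ : ∀ p {a l} → l ≤ a → + p ℚ./ 1 ℚ.≤ letter′ p a l
  letter-≥ p {a} {l} l≤a = begin
    + p ℚ./ 1                           ≡⟨ //-rightDividesʳ 1ℚ (+ p ℚ./ 1) ⟨
    + p ℚ./ 1 ℚ.+ 1ℚ ℚ.- 1ℚ             ≤⟨ +-monoʳ-≤ (+ p ℚ./ 1 ℚ.+ 1ℚ) (neg-antimono-≤ (half^-≤-1 (a ∸ l))) ⟩
    + p ℚ./ 1 ℚ.+ 1ℚ ℚ.- half^ (a ∸ l)  ≡⟨ letter-≡ p l≤a ⟨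
    letter′ p a l                       ∎
    where open ≤-Reasoning

  letter-< : ∀ {p a l i} → l ≤ a → p < i → letter′ p a l ℚ.< + i ℚ./ 1
  letter-< {p} {a} {l} {i} l≤a p<i = begin-strict
    letter′ p a l                       ≡⟨ letter-≡ p l≤a ⟩
    + p ℚ./ 1 ℚ.+ 1ℚ ℚ.- half^ (a ∸ l)  <⟨ +-monoʳ-< (+ p ℚ./ 1 ℚ.+ 1ℚ) (neg-antimono-< (half^-pos (a ∸ l))) ⟩
    + p ℚ./ 1 ℚ.+ 1ℚ ℚ.- 0ℚ             ≡⟨ +-identityʳ (+ p ℚ./ 1 ℚ.+ 1ℚ) ⟩
    + p ℚ./ 1 ℚ.+ 1ℚ                    ≡⟨ n/1+1≡suc-n/1 p ⟩
    + suc p ℚ./ 1                       ≤⟨ n/1-mono-≤ p<i ⟩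
    + i ℚ./ 1                           ∎
    where open ≤-Reasoning

  letter-strictAnti : ∀ p {a l l′} → l < l′ → l′ ≤ a → letter′ p a l′ ℚ.< letter′ p a l
  letter-strictAnti p {a} {l} {l′} l<l′ l′≤a = begin-strict
    letter′ p a l′                       ≡⟨ letter-≡ p l′≤a ⟩
    + p ℚ./ 1 ℚ.+ 1ℚ ℚ.- half^ (a ∸ l′)  <⟨ +-monoʳ-< (+ p ℚ./ 1 ℚ.+ 1ℚ) (neg-antimono-< (half^-strictlyDecreasing (ℕ.∸-monoʳ-< l<l′ l′≤a))) ⟩
    + p ℚ./ 1 ℚ.+ 1ℚ ℚ.- half^ (a ∸ l)   ≡⟨ letter-≡ p (ℕ.<⇒≤ (ℕ.<-≤-trans l<l′ l′≤a)) ⟨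
    letter′ p a l                        ∎
    where open ≤-Reasoning

  -- The letters following the descendants of node pa belong to later children of
  -- ancestors of pa, which have smaller numbers; so they start below pa.
  HeadBelow : ℕ → List ℚ → Set
  HeadBelow i []      = ⊤
  HeadBelow i (x ∷ _) = x ℚ.< + i ℚ./ 1

  headBelow-mono : ∀ {i j} c → i ≤ j → HeadBelow i c → HeadBelow j c
  headBelow-mono []      i≤j _   = tt
  headBelow-mono (x ∷ c) i≤j x<i = <-≤-trans x<i (n/1-mono-≤ i≤j)

  private
    fits-next : ∀ {k n a} → k + suc n ≤ suc a → suc k + n ≤ suc a
    fits-next {k} {n} {a} = subst (_≤ suc a) (ℕ.+-suc k n)

    fits-head : ∀ {k n a} → k + suc n ≤ suc a → k ≤ a
    fits-head {k} {n} fits = ℕ.m+n≤o⇒m≤o k (ℕ.≤-pred (fits-next fits))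

    ++-reassoc : ∀ {A : Set} (xs ys zs xs′ ys′ zs′ : List A) →
                 (xs ++ ys) ++ zs ≡ (xs′ ++ ys′) ++ zs′ → xs ++ (ys ++ zs) ≡ xs′ ++ (ys′ ++ zs′)
    ++-reassoc xs ys zs xs′ ys′ zs′ eq =
      trans (sym (++-assoc xs ys zs)) (trans eq (++-assoc xs′ ys′ zs′))

  cncV-headBelow : ∀ {n} pa a k j i (ts : Vec (Term arity) n) c →
    k + n ≤ suc a → pa < i → HeadBelow pa c → HeadBelow i (cncV pa a k j ts ++ c)
  cncV-headBelow pa a k j i []                c fits pa<i below = headBelow-mono c (ℕ.<⇒≤ pa<i) below
  cncV-headBelow pa a k j i (leaf ∷ ts)       c fits pa<i below =
    cncV-headBelow pa a (suc k) (j + 0) i ts c (fits-next fits) pa<i below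
  cncV-headBelow pa a k j i (node s vs ∷ ts) c fits pa<i below = letter-< (fits-head fits) pa<i

  cncV-head≢letter : ∀ {n} pa a k k′ j (ts : Vec (Term arity) n) c y →
    k′ + n ≤ suc a → k < k′ → HeadBelow pa c → cncV pa a k′ j ts ++ c ≢ letter′ pa a k ∷ y
  cncV-head≢letter pa a k k′ j [] [] y fits k<k′ below ()
  cncV-head≢letter pa a k k′ j [] (x ∷ c) y fits k<k′ below eq with ∷-injective eq
  ... | refl , _ = <-irrefl refl
    (<-≤-trans below (letter-≥ pa (ℕ.≤-pred (ℕ.<-≤-trans k<k′ (ℕ.m+n≤o⇒m≤o k′ fits)))))
  cncV-head≢letter pa a k k′ j (leaf ∷ ts) c y fits k<k′ below eq =
    cncV-head≢letter pa a k (suc k′) (j + 0) ts c y (fits-next fits) (ℕ.m<n⇒m<1+n k<k′) below eq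
  cncV-head≢letter pa a k k′ j (node s vs ∷ ts) c y fits k<k′ below eq =
    <⇒≢ (letter-strictAnti pa k<k′ (fits-head fits)) (proj₁ (∷-injective eq))

  cncV-injective : ∀ {n} pa a k i (ts ts′ : Vec (Term arity) n) {c c′ d d′} →
    k + n ≤ suc a → pa < i → HeadBelow pa c → HeadBelow pa c′ →
    dcs ts ++ d ≡ dcs ts′ ++ d′ → cncV pa a k i ts ++ c ≡ cncV pa a k i ts′ ++ c′ →
    ts ≡ ts′ × c ≡ c′ × d ≡ d′
  cncV-injective pa a k i [] [] fits pa<i below below′ dc-eq cnc-eq = refl , cnc-eq , dc-eq
  cncV-injective pa a k i (leaf ∷ ts) (leaf ∷ ts′) fits pa<i below below′ dc-eq cnc-eq
    with cncV-injective pa a (suc k) (i + 0) ts ts′ (fits-next fits)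
           (ℕ.<-≤-trans pa<i (ℕ.m≤m+n i 0)) below below′ dc-eq cnc-eq
  ... | refl , rest = refl , rest
  cncV-injective pa a k i (leaf ∷ ts) (node s′ vs′ ∷ ts′) {c} fits pa<i below below′ dc-eq cnc-eq =
    ⊥-elim (cncV-head≢letter pa a k (suc k) (i + 0) ts c _ (fits-next fits) (ℕ.n<1+n k) below cnc-eq)
  cncV-injective pa a k i (node s vs ∷ ts) (leaf ∷ ts′) {c′ = c′} fits pa<i below below′ dc-eq cnc-eq =
    ⊥-elim (cncV-head≢letter pa a k (suc k) (i + 0) ts′ c′ _ (fits-next fits) (ℕ.n<1+n k) below′ (sym cnc-eq))
  cncV-injective pa a k i (node s vs ∷ ts) (node s′ vs′ ∷ ts′) {c} {c′} {d} {d′}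
                 fits pa<i below below′ dc-eq cnc-eq
    with ∷-injective dc-eq
  ... | refl , dc-tail
    with cncV-injective i (arity s) 1 (suc i) vs vs′ ℕ.≤-refl ℕ.≤-refl
           (cncV-headBelow pa a (suc k) _ i ts c (fits-next fits) pa<i below)
           (cncV-headBelow pa a (suc k) _ i ts′ c′ (fits-next fits) pa<i below′)
           (++-reassoc (dcs vs) (dcs ts) d (dcs vs′) (dcs ts′) d′ dc-tail)
           (++-reassoc (cncV i (arity s) 1 (suc i) vs) _ c (cncV i (arity s) 1 (suc i) vs′) _ c′
             (proj₂ (∷-injective cnc-eq)))
  ... | refl , cnc-siblings , dc-siblings
    with cncV-injective pa a (suc k) (i + deg (node s vs)) ts ts′ (fits-next fits)
           (ℕ.<-≤-trans pa<i (ℕ.m≤m+n i _)) below below′ dc-siblings cnc-siblings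
  ... | refl , rest = refl , rest

  cnc-injective : ∀ {t u : Term arity} → dc t ≡ dc u → cnc t ≡ cnc u → t ≡ u
  cnc-injective {leaf}      {leaf}        dc-eq cnc-eq = refl
  cnc-injective {leaf}      {node _ _}    ()    cnc-eq
  cnc-injective {node _ _}  {leaf}        ()    cnc-eq
  cnc-injective {node s ts} {node s′ ts′} dc-eq cnc-eq with ∷-injective dc-eq
  ... | refl , dc-tail
    with cncV-injective 1 (arity s) 1 2 ts ts′ ℕ.≤-refl ℕ.≤-refl tt tt
           (cong (_++ []) dc-tail) (cong (_++ []) (proj₂ (∷-injective cnc-eq)))
  ... | refl , _ = refl

proposition2p2p3 : (S : Set) (arity : S → ℕ) (w : List S) (t u : Term arity) →
    dc t ≡ w → dc u ≡ w → cnc t ≡ cnc u → t ≡ u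
proposition2p2p3 S arity w t u dc-t dc-u = cnc-injective (trans dc-t (sym dc-u))
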